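{- Let $PS=D\cup LP\cup MP\cup IC$ be a minimal P2P system such that no negative literal occurs in any standard rule of $LP$. Then the relation $\sqsupseteq_{Min}$ is a partial order on the set $WM(PS)$ of weak models of $PS$.
   Context: Fix finite sets of predicate symbols, constants and variables. A peer identifier is a positive integer; a (peer) atom is $i{:}p(t_1,\dots,t_k)$; a literal is $A$ or $\mathit{not}\ A$ (negation as failure); built-in atoms are $X\,\theta\,Y$, $\theta\in\{<,>,\le,\ge,=,\ne\}$. Rules: standard rules $H\leftarrow\mathcal B$ with $H=i{:}h(X)$, $\mathcal B=j{:}p_1(X_1),\dots,j{:}p_m(X_m),\mathit{not}\ j{:}p_{m+1}(X_{m+1}),\dots,\mathit{not}\ j{:}p_n(X_n),\varphi$ ($\varphi$ built-ins); integrity constraints $\leftarrow\mathcal B$ with $\mathcal B$ of that form over one identifier; maximal mapping rules $H\leftharpoonup\mathcal B$ and minimal mapping rules $H\leftharpoondown\mathcal B$ with $H=i{:}h(X)$, $\mathcal B=j{:}p_1(X_1),\dots,j{:}p_m(X_m),\varphi$, $i\ne j$. Rules are safe. A peer is $P_i=\langle D_i,LP_i,MP_i,IC_i\rangle$ (ground facts with identifier $i$; standard rules with head/body identifier $i$; mapping rules with head identifier $i$; constraints with identifier $i$). A P2P system is $PS=\{P_1,\dots,P_n\}$ with identifiers of mapping rule bodies in $\{1,\dots,n\}$; $D,LP,MP,IC$ are unions, $PS$ identified with $D\cup LP\cup MP\cup IC$; it is a minimal P2P system if all its mapping rules are minimal mapping rules. Mapping predicates are those in heads of mapping rules; each is the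 head predicate of exactly one mapping rule. $M[MP]$ = atoms of interpretation $M$ with mapping predicate. $St(r)=H\leftarrow\mathcal B$ for mapping rule $r$; $St(Q)$ replaces each mapping rule by $St(r)$. Truth in $M$: conjunction true iff positive atoms in $M$, negated atoms not, built-ins hold; ground standard rule true iff body false or head in $M$; ground constraint true iff body false. $MM(Q)$ = inclusion-minimal models. Weak model: $\{M\}=MM(St(PS^M))$, with $PS^M$ obtained from $ground(PS)$ by removing every standard rule or constraint with a body literal $\mathit{not}\ A$, $A\in M$, deleting negative literals from the rest, and removing ground mapping rules whose head is not in $M$; $WM(PS)$ is the set of weak models. For weak models, $M\sqsupseteq_{Min}N$ iff $M[MP]\subseteq N[MP]$. -}

module Defs where

open import Data.Nat using (ℕ; _≤_) renaming (_<ᵇ_ to _<ℕᵇ_; _≤ᵇ_ to _≤ℕᵇ_; _≡ᵇ_ to _≡ℕᵇ_)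
open import Data.Fin using (Fin; toℕ)
open import Data.Bool using (Bool; true; false; not; _∧_; _∨_)
open import Data.List using (List; []; _∷_; length; lookup)
open import Data.List.Relation.Unary.All using (All)
open import Data.List.Relation.Unary.Any using (Any)
open import Data.List.Membership.Propositional using (_∈_)
open import Data.Vec using (Vec)
import Data.Vec as V
import Data.List as L
open import Data.Product using (Σ; _×_; _,_; proj₁; ∃)
open import Data.Sum using (_⊎_)
open import Relation.Binary.PropositionalEquality using (_≡_; _≢_)
open import Relation.Binary.Core using (Rel)

-- Fixed finite sets of predicate symbols (with arities), constants and
-- variables.  Constants are Fin nConst, ordered via toℕ (used by the
-- built-ins <, >, ≤, ≥).

record Signature : Set where
  field
    nPred  : ℕ
    arity  : Fin nPred → ℕ
    nConst : ℕ
    nVar   : ℕ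

open Signature public

-- Peer identifiers are natural numbers; the well-formedness condition
-- below requires them to lie in {1,…,n}.
PeerId : Set
PeerId = ℕ

data Op : Set where
  lt gt le ge eq ne : Op

evalOp : Op → ℕ → ℕ → Bool
evalOp lt x y = x <ℕᵇ y
evalOp gt x y = y <ℕᵇ x
evalOp le x y = x ≤ℕᵇ y
evalOp ge x y = y ≤ℕᵇ x
evalOp eq x y = x ≡ℕᵇ y
evalOp ne x y = not (x ≡ℕᵇ y)

data MapKind : Set where
  maximal minimal : MapKind

module _ (S : Signature) where

  data Term : Set where
    const : Fin (nConst S) → Term
    var   : Fin (nVar S) → Term

  record Atom : Set where
    constructor atom
    field
      pid  : PeerId
      pred : Fin (nPred S)
      args : Vec Term (arity S pred)

  record GAtom : Set where
    constructor gatom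
    field
      pid  : PeerId
      pred : Fin (nPred S)
      args : Vec (Fin (nConst S)) (arity S pred)

  record Builtin : Set where
    constructor builtin
    field
      op  : Op
      lhs : Term
      rhs : Term

  record GBuiltin : Set where
    constructor gbuiltin
    field
      op  : Op
      lhs : Fin (nConst S)
      rhs : Fin (nConst S)

  record StdRule : Set where
    field
      head : Atom
      pos  : List Atom
      neg  : List Atom
      bis  : List Builtin

  record Constraint : Set where
    field
      pos  : List Atom
      neg  : List Atom
      bis  : List Builtin

  -- mapping rule  H ⇀ B (maximal) or H ⇁ B (minimal)
  record MapRule : Set where
    field
      kind : MapKind
      head : Atom
      pos  : List Atom
      bis  : List Builtin

  -- A P2P system PS = {P₁,…,Pₙ}, identified with D ∪ LP ∪ MP ∪ IC
  -- (the peer Pᵢ consists of the facts/rules/constraints of identifier i).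
  record System : Set where
    field
      n  : ℕ
      D  : List GAtom
      LP : List StdRule
      MP : List MapRule
      IC : List Constraint

  data GRule : Set where
    std  : GAtom → List GAtom → List GAtom → List GBuiltin → GRule
    ic   : List GAtom → List GAtom → List GBuiltin → GRule
    mapr : MapKind → GAtom → List GAtom → List GBuiltin → GRule

  -- Ground rules of a program without mapping rules (image of St)
  data SRule : Set where
    std : GAtom → List GAtom → List GAtom → List GBuiltin → SRule
    ic  : List GAtom → List GAtom → List GBuiltin → SRule

  Interp : Set
  Interp = GAtom → Bool

  Subst : Set
  Subst = Fin (nVar S) → Fin (nConst S)

module _ {S : Signature} where

  InRange : ℕ → PeerId → Set
  InRange n i = 1 ≤ i × i ≤ n

  HasId : PeerId → Atom S → Set
  HasId i a = Atom.pid a ≡ i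

  OccursT : Fin (nVar S) → Term S → Set
  OccursT x t = t ≡ var x

  OccursA : Fin (nVar S) → Atom S → Set
  OccursA x a = Any (OccursT x) (V.toList (Atom.args a))

  OccursB : Fin (nVar S) → Builtin S → Set
  OccursB x b = OccursT x (Builtin.lhs b) ⊎ OccursT x (Builtin.rhs b)

  SafeStd : StdRule S → Set
  SafeStd r = ∀ x → (OccursA x (StdRule.head r) ⊎ Any (OccursA x) (StdRule.neg r)
                       ⊎ Any (OccursB x) (StdRule.bis r))
                    → Any (OccursA x) (StdRule.pos r)

  SafeIC : Constraint S → Set
  SafeIC r = ∀ x → (Any (OccursA x) (Constraint.neg r) ⊎ Any (OccursB x) (Constraint.bis r))
                   → Any (OccursA x) (Constraint.pos r)

  SafeMap : MapRule S → Set
  SafeMap r = ∀ x → (OccursA x (MapRule.head r) ⊎ Any (OccursB x) (MapRule.bis r))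
                    → Any (OccursA x) (MapRule.pos r)

  WFStd : ℕ → StdRule S → Set
  WFStd n r = Σ PeerId λ i → InRange n i × HasId i (StdRule.head r)
              × All (HasId i) (StdRule.pos r) × All (HasId i) (StdRule.neg r)
              × SafeStd r

  WFIC : ℕ → Constraint S → Set
  WFIC n r = Σ PeerId λ i → InRange n i
             × All (HasId i) (Constraint.pos r) × All (HasId i) (Constraint.neg r)
             × SafeIC r

  WFMap : ℕ → MapRule S → Set
  WFMap n r = Σ PeerId λ i → Σ PeerId λ j → InRange n i × InRange n j × i ≢ j
              × HasId i (MapRule.head r) × All (HasId j) (MapRule.pos r)
              × SafeMap r

  SamePred : Atom S → Atom S → Set
  SamePred a b = Atom.pid a ≡ Atom.pid b × Atom.pred a ≡ Atom.pred b

  record WellFormed (PS : System S) : Set where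
    field
      factsWF : All (λ a → InRange (System.n PS) (GAtom.pid a)) (System.D PS)
      lpWF    : All (WFStd (System.n PS)) (System.LP PS)
      icWF    : All (WFIC (System.n PS)) (System.IC PS)
      mpWF    : All (WFMap (System.n PS)) (System.MP PS)
      mpUnique : ∀ (k l : Fin (length (System.MP PS))) →
                 SamePred (MapRule.head (lookup (System.MP PS) k))
                          (MapRule.head (lookup (System.MP PS) l)) → k ≡ l

  IsMinimalSystem : System S → Set
  IsMinimalSystem PS = All (λ r → MapRule.kind r ≡ minimal) (System.MP PS)

  NoNegInLP : System S → Set
  NoNegInLP PS = All (λ r → StdRule.neg r ≡ []) (System.LP PS)

  gTerm : Subst S → Term S → Fin (nConst S)
  gTerm σ (const c) = c
  gTerm σ (var x)   = σ x

  gAtom : Subst S → Atom S → GAtom S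
  gAtom σ (atom i p ts) = gatom i p (V.map (gTerm σ) ts)

  gBuiltin : Subst S → Builtin S → GBuiltin S
  gBuiltin σ (builtin o l r) = gbuiltin o (gTerm σ l) (gTerm σ r)

  gStd : Subst S → StdRule S → GRule S
  gStd σ r = std (gAtom σ (StdRule.head r)) (L.map (gAtom σ) (StdRule.pos r))
                 (L.map (gAtom σ) (StdRule.neg r)) (L.map (gBuiltin σ) (StdRule.bis r))

  gIC : Subst S → Constraint S → GRule S
  gIC σ r = ic (L.map (gAtom σ) (Constraint.pos r))
               (L.map (gAtom σ) (Constraint.neg r)) (L.map (gBuiltin σ) (Constraint.bis r))

  gMap : Subst S → MapRule S → GRule S
  gMap σ r = mapr (MapRule.kind r) (gAtom σ (MapRule.head r))
                  (L.map (gAtom σ) (MapRule.pos r)) (L.map (gBuiltin σ) (MapRule.bis r))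

  -- ground(PS) as a set of ground rules (facts are rules with empty body)
  data Ground (PS : System S) : GRule S → Set where
    fact  : ∀ {a} → a ∈ System.D PS → Ground PS (std a [] [] [])
    stdI  : ∀ {r} → r ∈ System.LP PS → (σ : Subst S) → Ground PS (gStd σ r)
    icI   : ∀ {r} → r ∈ System.IC PS → (σ : Subst S) → Ground PS (gIC σ r)
    mapI  : ∀ {r} → r ∈ System.MP PS → (σ : Subst S) → Ground PS (gMap σ r)

  _∈I_ : GAtom S → Interp S → Set
  a ∈I M = M a ≡ true

  _∉I_ : GAtom S → Interp S → Set
  a ∉I M = M a ≡ false

  data Reduct (PS : System S) (M : Interp S) : GRule S → Set where
    stdR : ∀ {h pos neg bs} → Ground PS (std h pos neg bs) → All (_∉I M) neg
           → Reduct PS M (std h pos [] bs)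
    icR  : ∀ {pos neg bs} → Ground PS (ic pos neg bs) → All (_∉I M) neg
           → Reduct PS M (ic pos [] bs)
    mapR : ∀ {k h pos bs} → Ground PS (mapr k h pos bs) → h ∈I M
           → Reduct PS M (mapr k h pos bs)

  data St (Q : GRule S → Set) : SRule S → Set where
    stdS : ∀ {h pos neg bs} → Q (std h pos neg bs) → St Q (std h pos neg bs)
    icS  : ∀ {pos neg bs} → Q (ic pos neg bs) → St Q (ic pos neg bs)
    mapS : ∀ {k h pos bs} → Q (mapr k h pos bs) → St Q (std h pos [] bs)

  allB : {A : Set} → (A → Bool) → List A → Bool
  allB f []       = true
  allB f (x ∷ xs) = f x ∧ allB f xs

  evalB : GBuiltin S → Bool
  evalB (gbuiltin o l r) = evalOp o (toℕ l) (toℕ r)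

  bodyTrue : Interp S → List (GAtom S) → List (GAtom S) → List (GBuiltin S) → Bool
  bodyTrue M pos neg bs = allB M pos ∧ allB (λ a → not (M a)) neg ∧ allB evalB bs

  ruleTrue : Interp S → SRule S → Bool
  ruleTrue M (std h pos neg bs) = not (bodyTrue M pos neg bs) ∨ M h
  ruleTrue M (ic pos neg bs)    = not (bodyTrue M pos neg bs)

  IsModel : Interp S → (SRule S → Set) → Set
  IsModel M Q = ∀ r → Q r → ruleTrue M r ≡ true

  _⊆I_ : Interp S → Interp S → Set
  M ⊆I N = ∀ a → a ∈I M → a ∈I N

  _≐_ : Interp S → Interp S → Set
  M ≐ N = ∀ a → M a ≡ N a

  MinModel : (SRule S → Set) → Interp S → Set
  MinModel Q M = IsModel M Q × (∀ N → IsModel N Q → N ⊆I M → N ≐ M)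

  WeakModel : System S → Interp S → Set
  WeakModel PS M = MinModel (St (Reduct PS M)) M
                   × (∀ N → MinModel (St (Reduct PS M)) N → N ≐ M)

  WM : System S → Set
  WM PS = Σ (Interp S) (WeakModel PS)

  IsMappingAtom : System S → GAtom S → Set
  IsMappingAtom PS a = Σ (MapRule S) λ r → r ∈ System.MP PS
                       × Atom.pid (MapRule.head r) ≡ GAtom.pid a
                       × Atom.pred (MapRule.head r) ≡ GAtom.pred a

  ⊒Min : (PS : System S) → Rel (WM PS) _
  ⊒Min PS (M , _) (N , _) = ∀ a → IsMappingAtom PS a → a ∈I M → a ∈I N

  ≈WM : (PS : System S) → Rel (WM PS) _
  ≈WM PS (M , _) (N , _) = M ≐ N

-- If M[MP] ⊆ N[MP] for weak models M and N, then M ∩ N is still a model of St(PS^M):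
-- without negation in LP the Horn rules of PS^M are also rules of PS^N, every mapping
-- rule kept in PS^M has its head in M[MP] ⊆ N and so is kept in PS^N as well, and
-- constraints survive shrinking the interpretation.  Minimality of M then gives
-- M ⊆ M ∩ N, i.e. M ⊆ N; so M ⊒Min N implies M ⊆ N, and antisymmetry follows.
module Submission where

open import Defs
open import Data.Bool using (Bool; true; false; not; _∧_; _∨_)
open import Data.List using ([]; _∷_)
import Data.List as L
open import Data.List.Relation.Unary.All using (All; []; _∷_)
import Data.List.Relation.Unary.All as All
open import Data.Product using (_×_; _,_; proj₁; proj₂)
open import Relation.Binary.PropositionalEquality
open import Relation.Binary.Structures using (IsPartialOrder)

∧-true⁻ : ∀ {a b} → a ∧ b ≡ true → a ≡ true × b ≡ true
∧-true⁻ {true} b≡true = refl , b≡true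

∧-true⁺ : ∀ {a b} → a ≡ true → b ≡ true → a ∧ b ≡ true
∧-true⁺ refl b≡true = b≡true

implies⇒not∨≡true : ∀ {a b} → (a ≡ true → b ≡ true) → not a ∨ b ≡ true
implies⇒not∨≡true {false} _ = refl
implies⇒not∨≡true {true}  f = f refl

not∨≡true⇒implies : ∀ {a b} → not a ∨ b ≡ true → a ≡ true → b ≡ true
not∨≡true⇒implies b≡true refl = b≡true

-- allB is declared inside a module over a Signature, which it does not use.
module _ {S : Signature} {A : Set} {f : A → Bool} where

  allB⇒All : ∀ xs → allB {S = S} f xs ≡ true → All (λ x → f x ≡ true) xs
  allB⇒All []       _ = []
  allB⇒All (x ∷ xs) p = proj₁ (∧-true⁻ p) ∷ allB⇒All xs (proj₂ (∧-true⁻ p))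

  All⇒allB : ∀ {xs} → All (λ x → f x ≡ true) xs → allB {S = S} f xs ≡ true
  All⇒allB []         = refl
  All⇒allB (px ∷ pxs) = ∧-true⁺ px (All⇒allB pxs)

module _ {S : Signature} where

  _∩I_ : Interp S → Interp S → Interp S
  (M ∩I N) a = M a ∧ N a

  ∩I-⊆ˡ : ∀ M N → (M ∩I N) ⊆I M
  ∩I-⊆ˡ M N a p = proj₁ (∧-true⁻ {M a} p)

  ∩I-⊆ʳ : ∀ M N → (M ∩I N) ⊆I N
  ∩I-⊆ʳ M N a p = proj₂ (∧-true⁻ {M a} p)

  ⊆I-antisym : ∀ {M N : Interp S} → M ⊆I N → N ⊆I M → M ≐ N
  ⊆I-antisym {M} {N} M⊆N N⊆M a with M a in Ma
  ... | true  = sym (M⊆N a Ma)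
  ... | false with N a in Na
  ...   | false = refl
  ...   | true  = trans (sym Ma) (N⊆M a Na)

  positiveBody-mono : ∀ {M N : Interp S} {pos bs} → M ⊆I N →
                      bodyTrue M pos [] bs ≡ true → bodyTrue N pos [] bs ≡ true
  positiveBody-mono {M} {N} {pos} M⊆N p with ∧-true⁻ {allB {S = S} M pos} p
  ... | posM , bis =
    ∧-true⁺ (All⇒allB {S = S} (All.map (M⊆N _) (allB⇒All {S = S} pos posM))) bis

  hornRule-∩ : ∀ {M N : Interp S} {h pos bs} →
               ruleTrue M (std h pos [] bs) ≡ true → ruleTrue N (std h pos [] bs) ≡ true →
               ruleTrue (M ∩I N) (std h pos [] bs) ≡ true
  hornRule-∩ {M} {N} {h} {pos} {bs} Mr Nr = implies⇒not∨≡true λ body →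
    ∧-true⁺ (not∨≡true⇒implies Mr (positiveBody-mono {pos = pos} {bs} (∩I-⊆ˡ M N) body))
            (not∨≡true⇒implies Nr (positiveBody-mono {pos = pos} {bs} (∩I-⊆ʳ M N) body))

  constraint-antitone : ∀ {M N : Interp S} {pos bs} → N ⊆I M →
                        ruleTrue M (ic pos [] bs) ≡ true → ruleTrue N (ic pos [] bs) ≡ true
  constraint-antitone {M} {N} {pos} {bs} N⊆M Mr with bodyTrue N pos [] bs in bodyN
  ... | false = refl
  ... | true  = trans (sym (cong not (positiveBody-mono {pos = pos} {bs} N⊆M bodyN))) Mr

  gAtom-pid : (σ : Subst S) (a : Atom S) → GAtom.pid (gAtom σ a) ≡ Atom.pid a
  gAtom-pid σ (atom i p ts) = refl

  gAtom-pred : (σ : Subst S) (a : Atom S) → GAtom.pred (gAtom σ a) ≡ Atom.pred a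
  gAtom-pred σ (atom i p ts) = refl

module _ {S : Signature} {PS : System S} where

  groundMapping-head : ∀ {k h pos bs} → Ground PS (mapr k h pos bs) → IsMappingAtom PS h
  groundMapping-head (mapI {r} r∈MP σ) =
    r , r∈MP , sym (gAtom-pid σ (MapRule.head r)) , sym (gAtom-pred σ (MapRule.head r))

  mappingReduct-transfer : ∀ {M N : Interp S} {k h pos bs} →
                           (∀ a → IsMappingAtom PS a → a ∈I M → a ∈I N) →
                           Reduct PS M (mapr k h pos bs) → Reduct PS N (mapr k h pos bs)
  mappingReduct-transfer M⊒N (mapR g h∈M) = mapR g (M⊒N _ (groundMapping-head g) h∈M)

  module _ (noNeg : NoNegInLP PS) where

    groundStd-neg≡[] : ∀ {h pos neg bs} → Ground PS (std h pos neg bs) → neg ≡ []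
    groundStd-neg≡[] (fact _)       = refl
    groundStd-neg≡[] (stdI r∈LP σ) = cong (L.map (gAtom σ)) (All.lookup noNeg r∈LP)

    stdReduct-transfer : ∀ {M N : Interp S} {h pos neg bs} →
                         Reduct PS M (std h pos neg bs) → Reduct PS N (std h pos neg bs)
    stdReduct-transfer (stdR g _) = stdR g (subst (All _) (sym (groundStd-neg≡[] g)) [])

    ∩I-isModel : ∀ {M N : Interp S} →
                 IsModel M (St (Reduct PS M)) → IsModel N (St (Reduct PS N)) →
                 (∀ a → IsMappingAtom PS a → a ∈I M → a ∈I N) →
                 IsModel (M ∩I N) (St (Reduct PS M))
    ∩I-isModel M⊨ N⊨ M⊒N (std h pos [] bs) (stdS r@(stdR _ _)) =
      hornRule-∩ {h = h} {pos} {bs} (M⊨ _ (stdS r)) (N⊨ _ (stdS (stdReduct-transfer r)))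
    ∩I-isModel {M} {N} M⊨ N⊨ M⊒N (ic pos [] bs) (icS r@(icR _ _)) =
      constraint-antitone {pos = pos} {bs} (∩I-⊆ˡ M N) (M⊨ _ (icS r))
    ∩I-isModel M⊨ N⊨ M⊒N (std h pos [] bs) (mapS r) =
      hornRule-∩ {h = h} {pos} {bs} (M⊨ _ (mapS r)) (N⊨ _ (mapS (mappingReduct-transfer M⊒N r)))

    ⊒Min⇒⊆I : ∀ {x y} → ⊒Min PS x y → proj₁ x ⊆I proj₁ y
    ⊒Min⇒⊆I {M , (M⊨ , M-minimal) , _} {N , (N⊨ , _) , _} M⊒N a a∈M =
      ∩I-⊆ʳ M N a (trans (M∩N≐M a) a∈M)
      where
        M∩N≐M : (M ∩I N) ≐ M
        M∩N≐M = M-minimal (M ∩I N) (∩I-isModel M⊨ N⊨ M⊒N) (∩I-⊆ˡ M N)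

-- Neither well-formedness nor the kind of the mapping rules plays a role: St forgets the kind.
mainTheorem5 : ∀ (S : Signature) (PS : System S) →
               WellFormed PS → IsMinimalSystem PS → NoNegInLP PS →
               IsPartialOrder (≈WM PS) (⊒Min PS)
mainTheorem5 S PS _ _ noNeg = record
  { isPreorder = record
    { isEquivalence = record
      { refl  = λ _ → refl
      ; sym   = λ M≐N a → sym (M≐N a)
      ; trans = λ M≐N N≐K a → trans (M≐N a) (N≐K a)
      }
    ; reflexive = λ M≐N a _ a∈M → trans (sym (M≐N a)) a∈M
    ; trans     = λ M⊒N N⊒K a isMap a∈M → N⊒K a isMap (M⊒N a isMap a∈M)
    }
  ; antisym = λ {x} {y} M⊒N N⊒M →
      ⊆I-antisym (⊒Min⇒⊆I noNeg {x} {y} M⊒N) (⊒Min⇒⊆I noNeg {y} {x} N⊒M)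
  }
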